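{- Let $\mathcal{E}$ be a Zeckendorf collection for positive integers. Let $\tau^0$ be the zero coefficient function, and for each $n\ge 0$ let $\tau^{n+1}$ be the immediate successor of $\tau^n$ in $\mathcal{E}$. Then for each $n\ge 0$, $\tau^n$ is the immediate predecessor of $\tau^{n+1}$ in $\mathcal{E}$, and $\{\tau^n : n\ge 0\}=\mathcal{E}$.
   Context: A coefficient function is a map $\epsilon:\{1,2,3,\dots\}\to\{0,1,2,\dots\}$, written $\epsilon_k=\epsilon(k)$. For $i\ge1$, $\beta^i$ denotes the coefficient function with $\beta^i_i=1$ and $\beta^i_k=0$ for $k\ne i$. A coefficient function $\epsilon$ has finite support if $\epsilon_k=0$ for all sufficiently large $k$. For an interval $J$ of indices, $\mathrm{res}_J(\epsilon)=\sum_{k\in J}\epsilon_k\beta^k$, and "$\epsilon\equiv\mu$ on $J$" means $\epsilon_k=\mu_k$ for all $k\in J$. For finite-support coefficient functions, $\mu<_a\mu'$ (ascending lexicographic order) means that at the largest index $k$ with $\mu_k\ne\mu'_k$ one has $\mu_k<\mu'_k$. An ascendingly-ordered collection is a set $\mathcal{E}$ of finite-support coefficient functions containing the zero function and all $\beta^i$, ordered by $<_a$. For $\delta\in\mathcal{E}$, its immediate successor $\tilde\delta$ is the smallest element of $\mathcal{E}$ greater than $\delta$ (if it exists), and its immediate predecessor is the largest element of $\mathcal{E}$ less than $\delta$ (if it exists); $\hat\beta^n$ denotes the immediate predecessor of $\beta^n$ in $\mathcal{E}$. The collection $\mathcal{E}$ is called Zeckendorf for positive integers if (1) for each $\mu\in\mathcal{E}$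 there are at most finitely many elements of $\mathcal{E}$ less than $\mu$; and (2) for each $\mu\in\mathcal{E}$, if its immediate successor $\tilde\mu$ is not $\beta^1+\mu$, then there is an index $n\ge2$ such that $\mu\equiv\hat\beta^n$ on $[1,n)$ and $\tilde\mu=\beta^n+\mathrm{res}_{[n,\infty)}(\mu)$. -}

module Defs where

open import Data.Nat using (ℕ; zero; suc; _+_; _≤_; _<_; _≟_; _≤?_)
open import Data.Product using (Σ; ∃; _×_; _,_)
open import Data.Sum using (_⊎_)
open import Data.List using (List)
open import Data.List.Relation.Unary.Any using (Any)
open import Relation.Binary.PropositionalEquality using (_≡_)
open import Relation.Nullary using (¬_; yes; no)

-- A coefficient function ε : {1,2,3,...} → ℕ.  We represent it as a function
-- ℕ → ℕ and only ever look at its values at indices k ≥ 1 (the value at 0 is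
-- irrelevant; all notions below are invariant under changing it).
Coef : Set
Coef = ℕ → ℕ

_≐_ : Coef → Coef → Set
ε ≐ μ = ∀ k → 1 ≤ k → ε k ≡ μ k

𝟘 : Coef
𝟘 _ = 0

β : ℕ → Coef
β i k with i ≟ k
... | yes _ = 1
... | no _ = 0

_⊕_ : Coef → Coef → Coef
(ε ⊕ μ) k = ε k + μ k

res≥ : ℕ → Coef → Coef
res≥ n ε k with n ≤? k
... | yes _ = ε k
... | no _ = 0

EqOnBelow : ℕ → Coef → Coef → Set
EqOnBelow n ε μ = ∀ k → 1 ≤ k → k < n → ε k ≡ μ k

FiniteSupport : Coef → Set
FiniteSupport ε = ∃ λ N → ∀ k → N < k → ε k ≡ 0

_<a_ : Coef → Coef → Set
μ <a μ' = ∃ λ k → 1 ≤ k × μ k < μ' k × (∀ j → k < j → μ j ≡ μ' j)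

_≤a_ : Coef → Coef → Set
μ ≤a μ' = μ <a μ' ⊎ μ ≐ μ'

Collection : Set₁
Collection = Coef → Set

record AscendinglyOrdered (E : Collection) : Set where
  field
    respects : ∀ {ε μ} → ε ≐ μ → E ε → E μ
    finSupp  : ∀ ε → E ε → FiniteSupport ε
    has𝟘     : E 𝟘
    hasβ     : ∀ i → 1 ≤ i → E (β i)

IsSucc : Collection → Coef → Coef → Set
IsSucc E δ δ' = E δ' × δ <a δ' × (∀ μ → E μ → δ <a μ → δ' ≤a μ)

IsPred : Collection → Coef → Coef → Set
IsPred E δ δ' = E δ' × δ' <a δ × (∀ μ → E μ → μ <a δ → μ ≤a δ')

record Zeckendorf (E : Collection) : Set₁ where
  field
    ascending : AscendinglyOrdered E
    finBelow  : ∀ μ → E μ → Σ (List Coef) λ L →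
                  ∀ ν → E ν → ν <a μ → Any (ν ≐_) L
    succRule  : ∀ μ μ̃ → E μ → IsSucc E μ μ̃ → ¬ (μ̃ ≐ (β 1 ⊕ μ)) →
                  ∃ λ n → 2 ≤ n × Σ Coef λ β̂ → IsPred E (β n) β̂ ×
                    EqOnBelow n μ β̂ × (μ̃ ≐ (β n ⊕ res≥ n μ))

-- Every element of E has only finitely many predecessors, while the iterates
-- τ⁰ <a τ¹ <a τ² <a ⋯ form an infinite ascending chain starting at the least
-- element 𝟘. An element μ of E that is no τⁿ therefore lies above every τⁿ,
-- giving infinitely many elements of E below μ, which is absurd. That each τⁿ
-- is the immediate predecessor of τⁿ⁺¹ only needs <a to be total on
-- finitely supported coefficient functions.
{-# OPTIONS --safe #-}
module Submission where

open import Defs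
open import Data.Nat using (ℕ; zero; suc; _<_; _≤_; _⊔_; s≤s; z≤n)
open import Data.Nat.Properties
  using (<-cmp; <-trans; <-irrefl; ≤-refl; ≤-pred; ≤-<-trans;
         m≤n⇒m<n∨m≡n; n≮0; m≤m⊔n; m≤n⊔m)
open import Data.Product using (∃; _×_; _,_)
open import Data.Sum using (_⊎_; inj₁; inj₂)
open import Data.Empty using (⊥-elim)
open import Data.List using (List; length; lookup)
open import Data.List.Relation.Unary.Any using (Any; index)
open import Data.List.Relation.Unary.Any.Properties using (lookup-index)
open import Data.Fin using (toℕ)
open import Data.Fin.Properties using (pigeonhole; toℕ<n)
open import Relation.Binary.PropositionalEquality using (_≡_; refl; sym; trans; subst)
open import Relation.Binary.Definitions using (tri<; tri≈; tri>)
open import Relation.Nullary using (¬_)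

≐-sym : ∀ {a b} → a ≐ b → b ≐ a
≐-sym a≐b k 1≤k = sym (a≐b k 1≤k)

≐-trans : ∀ {a b c} → a ≐ b → b ≐ c → a ≐ c
≐-trans a≐b b≐c k 1≤k = trans (a≐b k 1≤k) (b≐c k 1≤k)

<a-irrefl : ∀ {a b} → a <a b → ¬ a ≐ b
<a-irrefl (k , 1≤k , aₖ<bₖ , _) a≐b = <-irrefl (a≐b k 1≤k) aₖ<bₖ

<a-trans : ∀ {a b c} → a <a b → b <a c → a <a c
<a-trans {a} {b} {c} (k , 1≤k , aₖ<bₖ , a≡b) (l , 1≤l , bₗ<cₗ , b≡c) with <-cmp k l
... | tri≈ _ refl _ =
  k , 1≤k , <-trans aₖ<bₖ bₗ<cₗ , λ j k<j → trans (a≡b j k<j) (b≡c j k<j)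
... | tri< k<l _ _ =
  l , 1≤l , subst (_< c l) (sym (a≡b l k<l)) bₗ<cₗ ,
  λ j l<j → trans (a≡b j (<-trans k<l l<j)) (b≡c j l<j)
... | tri> _ _ l<k =
  k , 1≤k , subst (a k <_) (b≡c k l<k) aₖ<bₖ ,
  λ j k<j → trans (a≡b j k<j) (b≡c j (<-trans l<k k<j))

<a⇒≱a : ∀ {a b} → a <a b → ¬ b ≤a a
<a⇒≱a a<b (inj₁ b<a) = <a-irrefl (<a-trans a<b b<a) (λ _ _ → refl)
<a⇒≱a a<b (inj₂ b≐a) = <a-irrefl a<b (≐-sym b≐a)

≮a-𝟘 : ∀ {μ ν} → ν ≐ 𝟘 → ¬ μ <a ν
≮a-𝟘 ν≐𝟘 (k , 1≤k , μₖ<νₖ , _) = n≮0 (subst (_ <_) (ν≐𝟘 k 1≤k) μₖ<νₖ)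

Trichotomy : Coef → Coef → Set
Trichotomy a b = a <a b ⊎ a ≐ b ⊎ b <a a

compare-agreeing-above : ∀ a b m → (∀ j → m < j → a j ≡ b j) → Trichotomy a b
compare-agreeing-above a b zero a≡b = inj₂ (inj₁ a≡b)
compare-agreeing-above a b (suc m) a≡b with <-cmp (a (suc m)) (b (suc m))
... | tri< aₘ<bₘ _ _ = inj₁ (suc m , s≤s z≤n , aₘ<bₘ , a≡b)
... | tri> _ _ bₘ<aₘ = inj₂ (inj₂ (suc m , s≤s z≤n , bₘ<aₘ , λ j m<j → sym (a≡b j m<j)))
... | tri≈ _ aₘ≡bₘ _ = compare-agreeing-above a b m a≡b′
  where
  a≡b′ : ∀ j → m < j → a j ≡ b j
  a≡b′ j m<j with m≤n⇒m<n∨m≡n m<j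
  ... | inj₁ 1+m<j = a≡b j 1+m<j
  ... | inj₂ refl = aₘ≡bₘ

<a-trichotomous : ∀ {a b} → FiniteSupport a → FiniteSupport b → Trichotomy a b
<a-trichotomous {a} {b} (M , a≡0) (N , b≡0) =
  compare-agreeing-above a b (M ⊔ N) λ j M⊔N<j →
    trans (a≡0 j (≤-<-trans (m≤m⊔n M N) M⊔N<j))
          (sym (b≡0 j (≤-<-trans (m≤n⊔m M N) M⊔N<j)))

increasing-not-listed : (f : ℕ → Coef) → (∀ {i j} → i < j → f i <a f j) →
  (L : List Coef) → ¬ (∀ j → j ≤ length L → Any (f j ≐_) L)
increasing-not-listed f f-increasing L listed =
  let i , j , i<j , same-index = pigeonhole ≤-refl (λ j → index (listed′ j)) in
  <a-irrefl (f-increasing i<j)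
    (≐-trans (lookup-index (listed′ i))
             (≐-sym (subst (λ p → f (toℕ j) ≐ lookup L p) (sym same-index)
                           (lookup-index (listed′ j)))))
  where
  listed′ : ∀ j → Any (f (toℕ j) ≐_) L
  listed′ j = listed (toℕ j) (≤-pred (toℕ<n j))

module _ {E : Collection} (ascending : AscendinglyOrdered E) where
  open AscendinglyOrdered ascending

  succ⇒pred : ∀ {δ δ′} → E δ → IsSucc E δ δ′ → IsPred E δ′ δ
  succ⇒pred {δ} {δ′} δ∈E (_ , δ<δ′ , δ′-least) = δ∈E , δ<δ′ , below-δ′⇒≤δ
    where
    below-δ′⇒≤δ : ∀ μ → E μ → μ <a δ′ → μ ≤a δ
    below-δ′⇒≤δ μ μ∈E μ<δ′ with <a-trichotomous (finSupp μ μ∈E) (finSupp δ δ∈E)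
    ... | inj₁ μ<δ = inj₁ μ<δ
    ... | inj₂ (inj₁ μ≐δ) = inj₂ μ≐δ
    ... | inj₂ (inj₂ δ<μ) = ⊥-elim (<a⇒≱a μ<δ′ (δ′-least μ μ∈E δ<μ))

  module Iterates (τ : ℕ → Coef) (τ0≐𝟘 : τ 0 ≐ 𝟘)
                  (τ-succ : ∀ n → IsSucc E (τ n) (τ (suc n))) where

    τ∈E : ∀ n → E (τ n)
    τ∈E zero = respects (≐-sym τ0≐𝟘) has𝟘
    τ∈E (suc n) = let τₙ₊₁∈E , _ = τ-succ n in τₙ₊₁∈E

    τ<τsuc : ∀ n → τ n <a τ (suc n)
    τ<τsuc n = let _ , τₙ<τₙ₊₁ , _ = τ-succ n in τₙ<τₙ₊₁

    τ-increasing : ∀ {i j} → i < j → τ i <a τ j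
    τ-increasing {i} {suc j} i<1+j with m≤n⇒m<n∨m≡n (≤-pred i<1+j)
    ... | inj₁ i<j = <a-trans (τ-increasing i<j) (τ<τsuc j)
    ... | inj₂ refl = τ<τsuc i

    Enumerated : Coef → Set
    Enumerated μ = ∃ λ n → μ ≐ τ n

    enumerated-or-above : ∀ {μ} → E μ → ∀ i → Enumerated μ ⊎ τ i <a μ
    enumerated-or-above {μ} μ∈E zero
      with <a-trichotomous (finSupp (τ 0) (τ∈E 0)) (finSupp μ μ∈E)
    ... | inj₁ τ₀<μ = inj₂ τ₀<μ
    ... | inj₂ (inj₁ τ₀≐μ) = inj₁ (0 , ≐-sym τ₀≐μ)
    ... | inj₂ (inj₂ μ<τ₀) = ⊥-elim (≮a-𝟘 τ0≐𝟘 μ<τ₀)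
    enumerated-or-above μ∈E (suc i) with enumerated-or-above μ∈E i
    ... | inj₁ enumerated = inj₁ enumerated
    ... | inj₂ τᵢ<μ with τ-succ i
    ...   | _ , _ , τᵢ₊₁-least with τᵢ₊₁-least _ μ∈E τᵢ<μ
    ...     | inj₁ τᵢ₊₁<μ = inj₂ τᵢ₊₁<μ
    ...     | inj₂ τᵢ₊₁≐μ = inj₁ (suc i , ≐-sym τᵢ₊₁≐μ)

    above⇒above-all-earlier : ∀ {μ i j} → τ i <a μ → j ≤ i → τ j <a μ
    above⇒above-all-earlier τᵢ<μ j≤i with m≤n⇒m<n∨m≡n j≤i
    ... | inj₁ j<i = <a-trans (τ-increasing j<i) τᵢ<μ
    ... | inj₂ refl = τᵢ<μ

    all-enumerated : (∀ μ → E μ → ∃ λ (L : List Coef) → ∀ ν → E ν → ν <a μ → Any (ν ≐_) L) →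
                     ∀ μ → E μ → Enumerated μ
    all-enumerated finBelow μ μ∈E with L , below-μ-listed ← finBelow μ μ∈E
                                with enumerated-or-above μ∈E (length L)
    ... | inj₁ μ-enumerated = μ-enumerated
    ... | inj₂ τ-above = ⊥-elim (increasing-not-listed τ τ-increasing L λ j j≤|L| →
            below-μ-listed (τ j) (τ∈E j) (above⇒above-all-earlier τ-above j≤|L|))

lemma2p2 : (E : Collection) → Zeckendorf E → (τ : ℕ → Coef) →
    τ 0 ≐ 𝟘 → (∀ n → IsSucc E (τ n) (τ (suc n))) →
    (∀ n → IsPred E (τ (suc n)) (τ n)) ×
    (∀ n → E (τ n)) × (∀ μ → E μ → ∃ λ n → μ ≐ τ n)
lemma2p2 E Z τ τ0≐𝟘 τ-succ =
  (λ n → succ⇒pred ascending (τ∈E n) (τ-succ n)) , τ∈E , all-enumerated finBelow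
  where
  open Zeckendorf Z
  open Iterates ascending τ τ0≐𝟘 τ-succ
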